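{- Let $F$ be a finite family of intervals, let $s$ be a minimal bad interval for $F$, and let $t$ be a bad interval for $F$ such that $s\not\subseteq t$. Then $t$ is bad for $F\downarrow s$.
   Context: For integers $a<b$, $[a,b)=\{x\in\mathbb{Z}: a\le x<b\}$; an interval is a nonempty set of this form. A family is a finite set of intervals. For a set $s$, $F|s=\{f\in F: f\subseteq s\}$. For an integer $x$, $N_x F$ is the number of members of $F$ containing $x$. An interval $s$ is good for $F$ if $N_x(F|s)\le 1$ for some $x\in s$, and bad otherwise; a minimal bad interval is a bad interval containing no other bad interval. Given an interval $s$, let $[a_1,b_1),\dots,[a_k,b_k)$ be the inclusion-maximal members of $F|s$, ordered so that $a_1<\dots<a_k$ (then $b_1<\dots<b_k$). If $a_{j+1}<b_j$ for $1\le j<k$, define $F\downarrow s=(F\setminus\{[a_1,b_1),\dots,[a_k,b_k)\})\cup\{[a_2,b_1),\dots,[a_k,b_{k-1})\}$; this condition holds whenever $s$ is a minimal bad interval for $F$, so $F\downarrow s$ is then defined. -}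

module Defs where

open import Data.Bool using (Bool; true; false; _∧_; _∨_; not; if_then_else_)
open import Data.Nat as ℕ using (ℕ)
open import Data.Integer using (ℤ; +_; _+_; _-_; _≤_; _<_; _≤ᵇ_; ∣_∣; 1ℤ)
open import Data.Integer.Properties using (_≟_)
open import Data.List using (List; []; _∷_; map; upTo; concatMap; filter; length)
open import Data.Bool.ListAction using (any)
open import Data.Product using (_×_; _,_; proj₁; proj₂; Σ; ∃)
open import Relation.Nullary using (¬_; Dec; yes; no)
open import Relation.Nullary.Decidable using (⌊_⌋)
open import Relation.Binary.PropositionalEquality using (_≡_)

-- A pair (a , b) stands for the integer set [a,b) = {x | a ≤ x < b}.
IntervalCode : Set
IntervalCode = ℤ × ℤ

lo hi : IntervalCode → ℤ
lo = proj₁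
hi = proj₂

IsInterval : IntervalCode → Set
IsInterval i = lo i < hi i

_∈ᵢ_ : ℤ → IntervalCode → Set
x ∈ᵢ i = lo i ≤ x × x < hi i

_⊆ᵢ_ : IntervalCode → IntervalCode → Set
i ⊆ᵢ j = ∀ x → x ∈ᵢ i → x ∈ᵢ j

_<ᵇ_ : ℤ → ℤ → Bool
x <ᵇ y = (x + 1ℤ) ≤ᵇ y

_==_ : ℤ → ℤ → Bool
x == y = ⌊ x ≟ y ⌋

memᵇ : ℤ → IntervalCode → Bool
memᵇ x i = (lo i ≤ᵇ x) ∧ (x <ᵇ hi i)

-- inclusion test; agrees with _⊆ᵢ_ whenever the first argument is nonempty
subᵇ : IntervalCode → IntervalCode → Bool
subᵇ i j = (lo j ≤ᵇ lo i) ∧ (hi i ≤ᵇ hi j)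

eqᵇ : IntervalCode → IntervalCode → Bool
eqᵇ i j = (lo i == lo j) ∧ (hi i == hi j)

range : ℤ → ℤ → List ℤ
range l h = if h ≤ᵇ l then [] else map (λ k → l + + k) (upTo ∣ h - l ∣)

-- all intervals [a,b) with [a,b) ⊆ s  (for s = [l,h): l ≤ a < b ≤ h)
pairsIn : IntervalCode → List IntervalCode
pairsIn s = concatMap (λ a → map (λ b → (a , b)) (range (a + 1ℤ) (hi s + 1ℤ))) (range (lo s) (hi s))

Family : Set
Family = IntervalCode → Bool

-- F is a finite family of intervals: members are genuine (nonempty)
-- intervals, and only finitely many codes are members (bounded support).
IsFamily : Family → Set
IsFamily F = (∀ i → F i ≡ true → IsInterval i)
           × ∃ λ L → ∃ λ U → ∀ i → F i ≡ true → (L ≤ lo i × hi i ≤ U)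

restrict : Family → IntervalCode → Family
restrict F s i = F i ∧ subᵇ i s

count : {A : Set} → (A → Bool) → List A → ℕ
count p xs = length (filter (λ a → Data.Bool.T? (p a)) xs)
  where import Data.Bool

-- N_x (F|s): number of members of F|s containing x.
-- Every member of F|s is an interval contained in s, hence occurs in pairsIn s.
N : ℤ → Family → IntervalCode → ℕ
N x F s = count (λ i → restrict F s i ∧ memᵇ x i) (pairsIn s)

Good : Family → IntervalCode → Set
Good F s = ∃ λ x → x ∈ᵢ s × N x F s ℕ.≤ 1

Bad : Family → IntervalCode → Set
Bad F s = ¬ Good F s

MinimalBad : Family → IntervalCode → Set
MinimalBad F s = Bad F s × (∀ u → IsInterval u → u ⊆ᵢ s → Bad F u → u ≡ s)

maximalᵇ : Family → IntervalCode → IntervalCode → Bool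
maximalᵇ F s i = restrict F s i
  ∧ not (any (λ j → restrict F s j ∧ not (eqᵇ i j) ∧ subᵇ i j) (pairsIn s))

consecᵇ : Family → IntervalCode → IntervalCode → IntervalCode → Bool
consecᵇ F s i j = maximalᵇ F s i ∧ maximalᵇ F s j ∧ (lo i <ᵇ lo j)
  ∧ not (any (λ k → maximalᵇ F s k ∧ (lo i <ᵇ lo k) ∧ (lo k <ᵇ lo j)) (pairsIn s))

newᵇ : Family → IntervalCode → IntervalCode → Bool
newᵇ F s c = any (λ i → any (λ j → consecᵇ F s i j ∧ (lo c == lo j) ∧ (hi c == hi i))
                               (pairsIn s)) (pairsIn s)

-- F ↓ s = (F \ {maximal members of F|s}) ∪ {[a_{j+1}, b_j) : 1 ≤ j < k}
_↓_ : Family → IntervalCode → Family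
(F ↓ s) c = (F c ∧ not (maximalᵇ F s c)) ∨ newᵇ F s c

-- Fix x ∈ t; we find two members of (F ↓ s)|t containing x. Members of F|t through x that are
-- not maximal in F|s survive in F ↓ s. The maximal members of F|s are ordered by both endpoints
-- at once, and consecutive ones i, j contribute the new interval [lo j, hi i), which is not in F:
-- otherwise [lo s, hi i) would be a bad interval strictly inside s. If some maximal member of F|s
-- through x is not contained in t, walking from it to the maximal members inside t produces new
-- intervals inside t through x. Otherwise every member of F|s through x lies in t. Then a member of
-- F|t through x leaving s survives next to a member coming from F|s; and if there is none, the
-- members through x of s and of t all lie in s ∩ t, which is therefore bad, so minimality of s
-- forces s ⊆ t.

module Submission where

open import Defs
open import Data.Bool using (Bool; true; false; T; T?; not; _∧_)
open import Data.Bool.Properties using (T-∧; T-∨; T-≡)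
open import Data.Bool.ListAction using (any)
open import Data.Empty using (⊥; ⊥-elim)
open import Data.Integer as ℤ using (ℤ; +_; -_; _+_; _-_; ∣_∣; _≤_; _<_; _≤?_; _<?_; _⊓_; _⊔_; 1ℤ; _≤ᵇ_)
import Data.Integer.Properties as ℤ
open import Data.Integer.Tactic.RingSolver using (solve-∀)
open import Data.List using (List; []; _∷_; map; filter; length)
open import Data.List.Membership.Propositional using (_∈_; find; lose)
open import Data.List.Membership.Propositional.Properties
  using (∈-map⁺; ∈-map⁻; ∈-upTo⁺; ∈-concat⁺′; ∈-filter⁺; ∈-filter⁻)
open import Data.List.Relation.Unary.All as All using (_∷_)
open import Data.List.Relation.Unary.All.Properties as All using (all-filter)
open import Data.List.Relation.Binary.Disjoint.Propositional using (Disjoint)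
open import Data.List.Relation.Unary.AllPairs as AllPairs using (_∷_)
import Data.List.Relation.Unary.AllPairs.Properties as AllPairs
open import Data.List.Relation.Unary.Any using (here; there; any?)
open import Data.List.Relation.Unary.Any.Properties using (any⁺; any⁻)
open import Data.List.Relation.Unary.Unique.Propositional using (Unique)
import Data.List.Relation.Unary.Unique.Propositional.Properties as Unique
import Data.List.Extrema ℤ.≤-totalOrder as Extrema
open import Data.Nat as ℕ using (s≤s; z≤n)
import Data.Nat.Properties as ℕ
open import Data.Product using (_×_; _,_; proj₁; proj₂; ∃; ∃₂)
open import Data.Sum using (_⊎_; inj₁; inj₂)
open import Function using (_∘_)
open import Function.Bundles using (Equivalence)
open import Relation.Binary.Definitions using (tri<; tri≈; tri>)
open import Relation.Binary.PropositionalEquality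
  using (_≡_; _≢_; refl; sym; trans; cong; cong₂; subst; subst₂; module ≡-Reasoning)
open import Relation.Nullary using (¬_; Dec; yes; no; _×-dec_; ¬?)
open import Relation.Nullary.Decidable using (toWitness; fromWitness; map′)
open import Relation.Unary using (Decidable)

open Equivalence using (to; from)

variable
  A : Set
  xs : List A
  F : Family
  a b c f g i j k m n u w : IntervalCode
  l h x y z : ℤ

infix 4 _⊑_ _⊑?_ _∈ᵢ?_
infixl 7 _∩_

_⊑_ : IntervalCode → IntervalCode → Set
i ⊑ j = lo j ≤ lo i × hi i ≤ hi j

_⊑?_ : ∀ i j → Dec (i ⊑ j)
i ⊑? j = lo j ≤? lo i ×-dec hi i ≤? hi j

_∈ᵢ?_ : ∀ x i → Dec (x ∈ᵢ i)
x ∈ᵢ? i = lo i ≤? x ×-dec x <? hi i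

⊑-refl : i ⊑ i
⊑-refl = ℤ.≤-refl , ℤ.≤-refl

⊑-trans : i ⊑ j → j ⊑ k → i ⊑ k
⊑-trans (lji , hij) (lkj , hjk) = ℤ.≤-trans lkj lji , ℤ.≤-trans hij hjk

⊑⇒⊆ᵢ : i ⊑ j → i ⊆ᵢ j
⊑⇒⊆ᵢ (lji , hij) x (ix , xi) = ℤ.≤-trans lji ix , ℤ.<-≤-trans xi hij

∈ᵢ-⊑ : x ∈ᵢ i → i ⊑ j → x ∈ᵢ j
∈ᵢ-⊑ {x} x∈i i⊑j = ⊑⇒⊆ᵢ i⊑j x x∈i

_∩_ : IntervalCode → IntervalCode → IntervalCode
i ∩ j = lo i ⊔ lo j , hi i ⊓ hi j

⊑-∩ : i ⊑ j → i ⊑ k → i ⊑ j ∩ k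
⊑-∩ (lji , hij) (lki , hik) = ℤ.⊔-lub lji lki , ℤ.⊓-glb hij hik

∩-⊑ˡ : i ∩ j ⊑ i
∩-⊑ˡ {i} {j} = ℤ.i≤i⊔j (lo i) (lo j) , ℤ.i⊓j≤i (hi i) (hi j)

∩-⊑ʳ : i ∩ j ⊑ j
∩-⊑ʳ {i} {j} = ℤ.i≤j⊔i (lo i) (lo j) , ℤ.i⊓j≤j (hi i) (hi j)

∈ᵢ-∩ : x ∈ᵢ i → x ∈ᵢ j → x ∈ᵢ (i ∩ j)
∈ᵢ-∩ {x} {i} {j} (ix , xi) (jx , xj) = ℤ.⊔-lub ix jx , x<⊓
  where
  x<⊓ : x < hi i ⊓ hi j
  x<⊓ with ℤ.⊓-sel (hi i) (hi j)
  ... | inj₁ e = subst (x <_) (sym e) xi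
  ... | inj₂ e = subst (x <_) (sym e) xj

+1≤⇒< : x + 1ℤ ≤ y → x < y
+1≤⇒< {x} {y} p = ℤ.suc[i]≤j⇒i<j (subst (_≤ y) (ℤ.+-comm x 1ℤ) p)

<⇒+1≤ : x < y → x + 1ℤ ≤ y
<⇒+1≤ {x} {y} p = subst (_≤ y) (ℤ.+-comm 1ℤ x) (ℤ.i<j⇒suc[i]≤j p)

≤⇒<+1 : x ≤ y → x < y + 1ℤ
≤⇒<+1 p = +1≤⇒< (ℤ.+-monoˡ-≤ 1ℤ p)

<ᵇ⇒< : T (x <ᵇ y) → x < y
<ᵇ⇒< = +1≤⇒< ∘ ℤ.≤ᵇ⇒≤

<⇒<ᵇ : x < y → T (x <ᵇ y)
<⇒<ᵇ = ℤ.≤⇒≤ᵇ ∘ <⇒+1≤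

≡⇒== : x ≡ y → T (x == y)
≡⇒== = fromWitness

memᵇ⇒∈ᵢ : T (memᵇ x i) → x ∈ᵢ i
memᵇ⇒∈ᵢ p = let l , h = to T-∧ p in ℤ.≤ᵇ⇒≤ l , <ᵇ⇒< h

∈ᵢ⇒memᵇ : x ∈ᵢ i → T (memᵇ x i)
∈ᵢ⇒memᵇ (l , h) = from T-∧ (ℤ.≤⇒≤ᵇ l , <⇒<ᵇ h)

subᵇ⇒⊑ : T (subᵇ i j) → i ⊑ j
subᵇ⇒⊑ p = let l , h = to T-∧ p in ℤ.≤ᵇ⇒≤ l , ℤ.≤ᵇ⇒≤ h

⊑⇒subᵇ : i ⊑ j → T (subᵇ i j)
⊑⇒subᵇ (l , h) = from T-∧ (ℤ.≤⇒≤ᵇ l , ℤ.≤⇒≤ᵇ h)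

eqᵇ⇒≡ : T (eqᵇ i j) → i ≡ j
eqᵇ⇒≡ {i} {j} p = let l , h = to (T-∧ {lo i == lo j}) p in cong₂ _,_ (toWitness l) (toWitness h)

≡⇒eqᵇ : i ≡ j → T (eqᵇ i j)
≡⇒eqᵇ {i} refl = from (T-∧ {lo i == lo i}) (≡⇒== refl , ≡⇒== refl)

T-not⁺ : ∀ {β} → ¬ T β → T (not β)
T-not⁺ {false} _ = _
T-not⁺ {true} ¬t = ¬t _

T-not⁻ : ∀ {β} → T (not β) → ¬ T β
T-not⁻ {false} _ ()

T-not-any⁺ : ∀ (p : A → Bool) xs → (∀ {a} → a ∈ xs → ¬ T (p a)) → T (not (any p xs))
T-not-any⁺ p xs none = T-not⁺ λ t → let _ , a∈xs , pa = find (any⁻ p xs t) in none a∈xs pa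

T-not-any⁻ : ∀ (p : A → Bool) {a} xs → T (not (any p xs)) → a ∈ xs → ¬ T (p a)
T-not-any⁻ p xs t a∈xs pa = T-not⁻ t (any⁺ p (lose a∈xs pa))

i+[j-i]≡j : ∀ l y → l + (y - l) ≡ y
i+[j-i]≡j = solve-∀

+-cancelˡ-≡ : ∀ l {m n} → l + m ≡ l + n → m ≡ n
+-cancelˡ-≡ l {m} {n} e = begin
  m              ≡⟨ sym (-i+[i+j]≡j l m) ⟩
  - l + (l + m)  ≡⟨ cong (_+_ (- l)) e ⟩
  - l + (l + n)  ≡⟨ -i+[i+j]≡j l n ⟩
  n              ∎
  where
  open ≡-Reasoning
  -i+[i+j]≡j : ∀ l m → - l + (l + m) ≡ m
  -i+[i+j]≡j = solve-∀

∈-range : ∀ {l h} → l ≤ y → y < h → y ∈ range l h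
∈-range {y} {l} {h} l≤y y<h with h ≤ᵇ l in h≤ᵇl
... | true  = ⊥-elim (ℤ.<⇒≱ (ℤ.≤-<-trans l≤y y<h) (ℤ.≤ᵇ⇒≤ (subst T (sym h≤ᵇl) _)))
... | false = subst (_∈ _) l+[y-l]≡y (∈-map⁺ (λ n → l + + n) (∈-upTo⁺ ∣y-l∣<∣h-l∣))
  where
  +∣y-l∣≡y-l : + ∣ y - l ∣ ≡ y - l
  +∣y-l∣≡y-l = ℤ.0≤i⇒+∣i∣≡i (ℤ.i≤j⇒0≤j-i l≤y)
  +∣h-l∣≡h-l : + ∣ h - l ∣ ≡ h - l
  +∣h-l∣≡h-l = ℤ.0≤i⇒+∣i∣≡i (ℤ.i≤j⇒0≤j-i (ℤ.<⇒≤ (ℤ.≤-<-trans l≤y y<h)))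
  l+[y-l]≡y : l + + ∣ y - l ∣ ≡ y
  l+[y-l]≡y = trans (cong (_+_ l) +∣y-l∣≡y-l) (i+[j-i]≡j l y)
  ∣y-l∣<∣h-l∣ : ∣ y - l ∣ ℕ.< ∣ h - l ∣
  ∣y-l∣<∣h-l∣ = ℤ.drop‿+<+ (subst₂ _<_ (sym +∣y-l∣≡y-l) (sym +∣h-l∣≡h-l) (ℤ.+-monoˡ-< (- l) y<h))

range-unique : ∀ l h → Unique (range l h)
range-unique l h with h ≤ᵇ l
... | true  = AllPairs.[]
... | false = Unique.map⁺ l+-injective (Unique.upTo⁺ _)
  where
  l+-injective : ∀ {m n} → l + + m ≡ l + + n → m ≡ n
  l+-injective = ℤ.+-injective ∘ +-cancelˡ-≡ l

∈-pairsIn : IsInterval c → c ⊑ u → c ∈ pairsIn u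
∈-pairsIn {a , b} {u} a<b (lu≤a , b≤hu) =
  ∈-concat⁺′ (∈-map⁺ (a ,_) (∈-range (<⇒+1≤ a<b) (≤⇒<+1 b≤hu)))
             (∈-map⁺ _ (∈-range lu≤a (ℤ.<-≤-trans a<b b≤hu)))

pairsIn-unique : ∀ u → Unique (pairsIn u)
pairsIn-unique u =
  Unique.concat⁺ (All.map⁺ (All.universal row-unique _))
                 (AllPairs.map⁺ (AllPairs.map rows-disjoint (range-unique (lo u) (hi u))))
  where
  row : ℤ → List IntervalCode
  row l = map (l ,_) (range (l + 1ℤ) (hi u + 1ℤ))
  row-unique : ∀ l → Unique (row l)
  row-unique l = Unique.map⁺ (cong proj₂) (range-unique (l + 1ℤ) (hi u + 1ℤ))
  rows-disjoint : ∀ {l l′} → l ≢ l′ → Disjoint (row l) (row l′)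
  rows-disjoint l≢l′ (c∈row , c∈row′) with ∈-map⁻ _ c∈row | ∈-map⁻ _ c∈row′
  ... | _ , _ , refl | _ , _ , e = l≢l′ (cong proj₁ e)

1≤length : ∀ {p : A} → p ∈ xs → 1 ℕ.≤ length xs
1≤length (here _)  = s≤s z≤n
1≤length (there _) = s≤s z≤n

2≤length : ∀ {p q : A} → p ∈ xs → q ∈ xs → p ≢ q → 2 ℕ.≤ length xs
2≤length (here refl) (here refl) p≢q = ⊥-elim (p≢q refl)
2≤length (here refl) (there q∈)  _   = s≤s (1≤length q∈)
2≤length (there p∈)  (here refl) _   = s≤s (1≤length p∈)
2≤length (there p∈)  (there q∈)  p≢q = ℕ.m≤n⇒m≤1+n (2≤length p∈ q∈ p≢q)

two-distinct : Unique xs → 2 ℕ.≤ length xs → ∃₂ λ (p q : A) → p ≢ q × p ∈ xs × q ∈ xs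
two-distinct {xs = p ∷ q ∷ _} ((p≢q ∷ _) ∷ _) _ = p , q , p≢q , here refl , there (here refl)
two-distinct {xs = _ ∷ []}    _ (s≤s ())

record Member (F : Family) (u : IntervalCode) (x : ℤ) (a : IntervalCode) : Set where
  constructor member
  field
    ∈F : T (F a)
    ⊑u : a ⊑ u
    ∋x : x ∈ᵢ a

CoveredTwice : Family → IntervalCode → ℤ → Set
CoveredTwice F u x = ∃₂ λ a b → a ≢ b × Member F u x a × Member F u x b

covers? : ∀ F u x → Decidable (λ a → T (restrict F u a ∧ memᵇ x a))
covers? F u x a = T? (restrict F u a ∧ memᵇ x a)

member⇒∈pairsIn : Member F u x a → a ∈ pairsIn u
member⇒∈pairsIn (member _ a⊑u (ax , xa)) = ∈-pairsIn (ℤ.≤-<-trans ax xa) a⊑u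

member⁺ : Member F u x a → T (restrict F u a ∧ memᵇ x a)
member⁺ (member Fa a⊑u x∈a) = from T-∧ (from T-∧ (Fa , ⊑⇒subᵇ a⊑u) , ∈ᵢ⇒memᵇ x∈a)

member⁻ : T (restrict F u a ∧ memᵇ x a) → Member F u x a
member⁻ t = let r , x∈a = to T-∧ t; Fa , a⊑u = to T-∧ r in member Fa (subᵇ⇒⊑ a⊑u) (memᵇ⇒∈ᵢ x∈a)

bad⇒coveredTwice : Bad F u → x ∈ᵢ u → CoveredTwice F u x
bad⇒coveredTwice {F = F} {u = u} {x = x} bad x∈u =
  let a , b , a≢b , a∈ , b∈ = two-distinct (Unique.filter⁺ (covers? F u x) (pairsIn-unique u))
                                           (ℕ.≰⇒> λ N≤1 → bad (_ , x∈u , N≤1))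
  in a , b , a≢b , member⁻ (proj₂ (∈-filter⁻ (covers? F u x) {xs = pairsIn u} a∈))
                  , member⁻ (proj₂ (∈-filter⁻ (covers? F u x) {xs = pairsIn u} b∈))

coveredTwice⇒bad : (∀ x → x ∈ᵢ u → CoveredTwice F u x) → Bad F u
coveredTwice⇒bad {u = u} {F = F} covered (x , x∈u , N≤1) =
  let a , b , a≢b , Ma , Mb = covered x x∈u
  in ℕ.<⇒≱ (2≤length (∈-filter⁺ (covers? F u x) (member⇒∈pairsIn Ma) (member⁺ Ma))
                      (∈-filter⁺ (covers? F u x) (member⇒∈pairsIn Mb) (member⁺ Mb)) a≢b) N≤1

coveredTwice-mono : (∀ {a} → Member F u x a → a ⊑ w) → CoveredTwice F u x → CoveredTwice F w x
coveredTwice-mono inW (a , b , a≢b , Ma@(member Fa _ xa) , Mb@(member Fb _ xb)) =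
  a , b , a≢b , member Fa (inW Ma) xa , member Fb (inW Mb) xb

member? : ∀ F u x a → Dec (Member F u x a)
member? F u x a = map′ member⁻ member⁺ (covers? F u x a)

-- A member of F|u through y ≤ x either contains x or ends by x (dually for coveredTwice-right).
coveredTwice-left : y ≤ x → x < hi w → lo w ≤ lo u → (∀ {a} → Member F u x a → a ⊑ w) →
                    CoveredTwice F u y → CoveredTwice F w y
coveredTwice-left {y = y} {x = x} {w = w} {u = u} {F = F} y≤x x<w w≤u inW = coveredTwice-mono inW′
  where
  inW′ : Member F u y a → a ⊑ w
  inW′ {a} (member Fa (u≤a , a≤u) (a≤y , _)) with x <? hi a
  ... | yes x<a = inW (member Fa (u≤a , a≤u) (ℤ.≤-trans a≤y y≤x , x<a))
  ... | no  x≮a = ℤ.≤-trans w≤u u≤a , ℤ.<⇒≤ (ℤ.≤-<-trans (ℤ.≮⇒≥ x≮a) x<w)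

coveredTwice-right : x ≤ y → lo w ≤ x → hi u ≤ hi w → (∀ {a} → Member F u x a → a ⊑ w) →
                     CoveredTwice F u y → CoveredTwice F w y
coveredTwice-right {x = x} {y = y} {w = w} {u = u} {F = F} x≤y w≤x u≤w inW = coveredTwice-mono inW′
  where
  inW′ : Member F u y a → a ⊑ w
  inW′ {a} (member Fa (u≤a , a≤u) (_ , y<a)) with lo a ≤? x
  ... | yes a≤x = inW (member Fa (u≤a , a≤u) (a≤x , ℤ.≤-<-trans x≤y y<a))
  ... | no  a≰x = ℤ.<⇒≤ (ℤ.≤-<-trans w≤x (ℤ.≰⇒> a≰x)) , ℤ.≤-trans a≤u u≤w

bad-∩ : Bad F u → Bad F w → x ∈ᵢ u → x ∈ᵢ w →
        (∀ {a} → Member F u x a → a ⊑ w) → (∀ {a} → Member F w x a → a ⊑ u) → Bad F (u ∩ w)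
bad-∩ {F = F} {u = u} {w = w} {x = x} bad-u bad-w x∈u x∈w u→w w→u = coveredTwice⇒bad covered
  where
  inU : Member F u x a → a ⊑ u ∩ w
  inU M = ⊑-∩ (Member.⊑u M) (u→w M)
  inW : Member F w x a → a ⊑ u ∩ w
  inW M = ⊑-∩ (w→u M) (Member.⊑u M)
  at-u : y ∈ᵢ (u ∩ w) → CoveredTwice F u y
  at-u y∈u∩w = bad⇒coveredTwice bad-u (∈ᵢ-⊑ y∈u∩w ∩-⊑ˡ)
  at-w : y ∈ᵢ (u ∩ w) → CoveredTwice F w y
  at-w y∈u∩w = bad⇒coveredTwice bad-w (∈ᵢ-⊑ y∈u∩w (∩-⊑ʳ {u}))
  covered : ∀ y → y ∈ᵢ (u ∩ w) → CoveredTwice F (u ∩ w) y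
  covered y y∈u∩w with ∈ᵢ-∩ x∈u x∈w | ℤ.≤-total y x | ℤ.⊔-sel (lo u) (lo w) | ℤ.⊓-sel (hi u) (hi w)
  ... | _ , x<∩ | inj₁ y≤x | inj₁ lo≡u | _ =
    coveredTwice-left y≤x x<∩ (ℤ.≤-reflexive lo≡u) inU (at-u y∈u∩w)
  ... | _ , x<∩ | inj₁ y≤x | inj₂ lo≡w | _ =
    coveredTwice-left y≤x x<∩ (ℤ.≤-reflexive lo≡w) inW (at-w y∈u∩w)
  ... | ∩≤x , _ | inj₂ x≤y | _ | inj₁ hi≡u =
    coveredTwice-right x≤y ∩≤x (ℤ.≤-reflexive (sym hi≡u)) inU (at-u y∈u∩w)
  ... | ∩≤x , _ | inj₂ x≤y | _ | inj₂ hi≡w =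
    coveredTwice-right x≤y ∩≤x (ℤ.≤-reflexive (sym hi≡w)) inW (at-w y∈u∩w)

module _ {P : A → Set} (P? : Decidable P) (f : A → ℤ) where

  argmax-satisfying : ∀ {p} xs → P p → ∃ λ q → P q × (∀ {k} → k ∈ xs → P k → f k ≤ f q)
  argmax-satisfying {p} xs Pp =
    Extrema.argmax f p (filter P? xs) , Extrema.argmax-all f Pp (all-filter P? xs) ,
    λ k∈xs Pk → All.lookup (Extrema.f[xs]≤f[argmax] p (filter P? xs)) (∈-filter⁺ P? k∈xs Pk)

  argmin-satisfying : ∀ {p} xs → P p → ∃ λ q → P q × (∀ {k} → k ∈ xs → P k → f q ≤ f k)
  argmin-satisfying {p} xs Pp =
    Extrema.argmin f p (filter P? xs) , Extrema.argmin-all f Pp (all-filter P? xs) ,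
    λ k∈xs Pk → All.lookup (Extrema.f[argmin]≤f[xs] p (filter P? xs)) (∈-filter⁺ P? k∈xs Pk)

len : IntervalCode → ℤ
len c = hi c - lo c

⊑-len-≡ : i ⊑ j → len j ≤ len i → i ≡ j
⊑-len-≡ {i} {j} (lj≤li , hi≤hj) len≤ = cong₂ _,_ lo≡ hi≡
  where
  lo≡ : lo i ≡ lo j
  lo≡ = ℤ.≤-antisym (ℤ.≮⇒≥ λ lj<li → ℤ.<⇒≱ (ℤ.+-mono-≤-< hi≤hj (ℤ.neg-mono-< lj<li)) len≤) lj≤li
  hi≡ : hi i ≡ hi j
  hi≡ = ℤ.≤-antisym hi≤hj (ℤ.≮⇒≥ λ hi<hj → ℤ.<⇒≱ (ℤ.+-mono-<-≤ hi<hj (ℤ.neg-mono-≤ lj≤li)) len≤)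

∃?-within : {P : A → Set} → Decidable P → (zs : List A) → (∀ {p} → P p → p ∈ zs) → Dec (∃ P)
∃?-within P? zs complete with any? P? zs
... | yes some = let p , _ , Pp = find some in yes (p , Pp)
... | no  none = no λ (p , Pp) → none (lose (complete Pp) Pp)

module MaximalMembers (F : Family) (F-nonempty : ∀ {i} → T (F i) → IsInterval i) (s : IntervalCode) where

  Max : IntervalCode → Set
  Max c = T (maximalᵇ F s c)

  Max? : Decidable Max
  Max? c = T? (maximalᵇ F s c)

  ∈F⇒∈pairsIn : T (F c) → c ⊑ s → c ∈ pairsIn s
  ∈F⇒∈pairsIn Fc c⊑s = ∈-pairsIn (F-nonempty Fc) c⊑s

  private
    strictlyAboveᵇ : IntervalCode → IntervalCode → Bool
    strictlyAboveᵇ c j = restrict F s j ∧ not (eqᵇ c j) ∧ subᵇ c j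

  max⇒∈F×⊑ : Max c → T (F c) × c ⊑ s
  max⇒∈F×⊑ {c} m = let Fc , c⊑s = to T-∧ (proj₁ (to (T-∧ {restrict F s c}) m)) in Fc , subᵇ⇒⊑ c⊑s

  max⇒∈F : Max c → T (F c)
  max⇒∈F = proj₁ ∘ max⇒∈F×⊑

  max⇒⊑ : Max c → c ⊑ s
  max⇒⊑ = proj₂ ∘ max⇒∈F×⊑

  max⇒∈pairsIn : Max c → c ∈ pairsIn s
  max⇒∈pairsIn m = ∈F⇒∈pairsIn (max⇒∈F m) (max⇒⊑ m)

  max-maximal : Max c → T (F j) → j ⊑ s → c ⊑ j → c ≡ j
  max-maximal {c} {j} m Fj j⊑s c⊑j with T? (eqᵇ c j)
  ... | yes c=j = eqᵇ⇒≡ c=j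
  ... | no  c≠j = ⊥-elim (T-not-any⁻ (strictlyAboveᵇ c) (pairsIn s) (proj₂ (to T-∧ m))
                                       (∈F⇒∈pairsIn Fj j⊑s) j-above-c)
    where
    j-above-c : T (strictlyAboveᵇ c j)
    j-above-c = from T-∧ (from T-∧ (Fj , ⊑⇒subᵇ j⊑s) , from T-∧ (T-not⁺ c≠j , ⊑⇒subᵇ c⊑j))

  maximal⇒max : T (F c) → c ⊑ s → (∀ {j} → T (F j) → j ⊑ s → c ⊑ j → c ≡ j) → Max c
  maximal⇒max {c} Fc c⊑s maximal =
    from T-∧ (from T-∧ (Fc , ⊑⇒subᵇ c⊑s) , T-not-any⁺ (strictlyAboveᵇ c) (pairsIn s) notAbove)
    where
    notAbove : j ∈ pairsIn s → ¬ T (strictlyAboveᵇ c j)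
    notAbove _ t = let Fj∧j⊑s , c≠j∧c⊑j = to T-∧ t
                       Fj , j⊑s = to T-∧ Fj∧j⊑s
                       c≠j , c⊑j = to T-∧ c≠j∧c⊑j
                   in T-not⁻ c≠j (≡⇒eqᵇ (maximal Fj (subᵇ⇒⊑ j⊑s) (subᵇ⇒⊑ c⊑j)))

  ∃-max-above : T (F g) → g ⊑ s → ∃ λ M → Max M × g ⊑ M
  ∃-max-above {g} Fg g⊑s =
    let M , (FM , M⊑s , g⊑M) , longest = argmax-satisfying Above? len (pairsIn s) (Fg , g⊑s , ⊑-refl)
        maximal : ∀ {j} → T (F j) → j ⊑ s → M ⊑ j → M ≡ j
        maximal Fj j⊑s M⊑j = ⊑-len-≡ M⊑j (longest (∈F⇒∈pairsIn Fj j⊑s) (Fj , j⊑s , ⊑-trans g⊑M M⊑j))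
    in M , maximal⇒max FM M⊑s maximal , g⊑M
    where
    Above? : Decidable (λ c → T (F c) × c ⊑ s × g ⊑ c)
    Above? c = T? (F c) ×-dec c ⊑? s ×-dec g ⊑? c

  max-lo-injective : Max i → Max j → lo i ≡ lo j → i ≡ j
  max-lo-injective {i} {j} mi mj lo≡ with hi i ≤? hi j
  ... | yes hi≤ = max-maximal mi (max⇒∈F mj) (max⇒⊑ mj) (ℤ.≤-reflexive (sym lo≡) , hi≤)
  ... | no  hi≰ = sym (max-maximal mj (max⇒∈F mi) (max⇒⊑ mi) (ℤ.≤-reflexive lo≡ , ℤ.<⇒≤ (ℤ.≰⇒> hi≰)))

  max-hi-strictMono : Max i → Max j → lo i < lo j → hi i < hi j
  max-hi-strictMono {i} {j} mi mj lo< with hi i <? hi j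
  ... | yes hi< = hi<
  ... | no  hi≮ = ⊥-elim (ℤ.<-irrefl (sym (cong lo j≡i)) lo<)
    where
    j≡i : j ≡ i
    j≡i = max-maximal mj (max⇒∈F mi) (max⇒⊑ mi) (ℤ.<⇒≤ lo< , ℤ.≮⇒≥ hi≮)

  max-hi-mono : Max i → Max j → lo i ≤ lo j → hi i ≤ hi j
  max-hi-mono {i} {j} mi mj lo≤ with ℤ.<-cmp (lo i) (lo j)
  ... | tri< lo< _ _ = ℤ.<⇒≤ (max-hi-strictMono mi mj lo<)
  ... | tri≈ _ lo≡ _ = ℤ.≤-reflexive (cong hi (max-lo-injective mi mj lo≡))
  ... | tri> _ _ lo> = ⊥-elim (ℤ.≤⇒≯ lo≤ lo>)

  max-lo-cmp : Max i → Max j → i ≢ j → lo i < lo j ⊎ lo j < lo i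
  max-lo-cmp {i} {j} mi mj i≢j with ℤ.<-cmp (lo i) (lo j)
  ... | tri< lo< _ _ = inj₁ lo<
  ... | tri≈ _ lo≡ _ = ⊥-elim (i≢j (max-lo-injective mi mj lo≡))
  ... | tri> _ _ lo> = inj₂ lo>

  Consecutive : IntervalCode → IntervalCode → Set
  Consecutive i j = Max i × Max j × lo i < lo j × (∀ {k} → Max k → lo i < lo k → lo k < lo j → ⊥)

  successor : Max i → Max b → lo i < lo b → ∃ λ j → Consecutive i j × lo j ≤ lo b
  successor {i} {b} mi mb i<b =
    let j , (mj , i<j) , leftmost = argmin-satisfying After? lo (pairsIn s) (mb , i<b)
    in j , (mi , mj , i<j , λ mk i<k k<j → ℤ.<⇒≱ k<j (leftmost (max⇒∈pairsIn mk) (mk , i<k))) ,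
       leftmost (max⇒∈pairsIn mb) (mb , i<b)
    where
    After? : Decidable (λ k → Max k × lo i < lo k)
    After? k = Max? k ×-dec lo i <? lo k

  predecessor : Max a → Max j → lo a < lo j → ∃ λ i → Consecutive i j × lo a ≤ lo i
  predecessor {a} {j} ma mj a<j =
    let i , (mi , i<j) , rightmost = argmax-satisfying Before? lo (pairsIn s) (ma , a<j)
    in i , (mi , mj , i<j , λ mk i<k k<j → ℤ.<⇒≱ i<k (rightmost (max⇒∈pairsIn mk) (mk , k<j))) ,
       rightmost (max⇒∈pairsIn ma) (ma , a<j)
    where
    Before? : Decidable (λ k → Max k × lo k < lo j)
    Before? k = Max? k ×-dec lo k <? lo j

  newInterval : IntervalCode → IntervalCode → IntervalCode
  newInterval i j = lo j , hi i

  consecutive⇒consecᵇ : Consecutive i j → T (consecᵇ F s i j)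
  consecutive⇒consecᵇ {i} {j} (mi , mj , i<j , gap) =
    from T-∧ (mi , from T-∧ (mj , from T-∧ (<⇒<ᵇ i<j , T-not-any⁺ _ (pairsIn s) nothingBetween)))
    where
    nothingBetween : k ∈ pairsIn s → ¬ T (maximalᵇ F s k ∧ (lo i <ᵇ lo k) ∧ (lo k <ᵇ lo j))
    nothingBetween _ t = let mk , i<k∧k<j = to T-∧ t
                             i<k , k<j = to T-∧ i<k∧k<j
                         in gap mk (<ᵇ⇒< i<k) (<ᵇ⇒< k<j)

  newInterval∈↓ : Consecutive i j → T ((F ↓ s) (newInterval i j))
  newInterval∈↓ {i} {j} C@(mi , mj , _) =
    from T-∨ (inj₂ (any⁺ _ (lose (max⇒∈pairsIn mi) (any⁺ _ (lose (max⇒∈pairsIn mj) witness)))))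
    where
    witness : T (consecᵇ F s i j ∧ (lo j == lo j) ∧ (hi i == hi i))
    witness = from T-∧ (consecutive⇒consecᵇ C , from (T-∧ {lo j == lo j}) (≡⇒== refl , ≡⇒== refl))

  survivor∈↓ : T (F f) → ¬ Max f → T ((F ↓ s) f)
  survivor∈↓ Ff ¬mf = from T-∨ (inj₁ (from T-∧ (Ff , T-not⁺ ¬mf)))

module MinimalBadInterval (F : Family) (F-nonempty : ∀ {i} → T (F i) → IsInterval i)
                          (s : IntervalCode) (minimal : MinimalBad F s) where

  open MaximalMembers F F-nonempty s

  bad-s : Bad F s
  bad-s = proj₁ minimal

  bad-⊑⇒≡ : IsInterval u → u ⊑ s → Bad F u → u ≡ s
  bad-⊑⇒≡ u-nonempty u⊑s = proj₂ minimal _ u-nonempty (⊑⇒⊆ᵢ u⊑s)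

  -- Otherwise [lo s, hi i) would be bad: from lo j on, i and the new interval cover each point,
  -- and before lo j every member of F|s lies under a maximal member that ends by hi i.
  newInterval∉F : Consecutive i j → ¬ T (F (newInterval i j))
  newInterval∉F {i} {j} (mi , mj , i<j , gap) Fn =
    ℤ.<-irrefl (cong hi (bad-⊑⇒≡ init-nonempty init⊑s (coveredTwice⇒bad covered))) hi<hs
    where
    init : IntervalCode
    init = lo s , hi i
    s≤i : lo s ≤ lo i
    s≤i = proj₁ (max⇒⊑ mi)
    hi<hs : hi i < hi s
    hi<hs = ℤ.<-≤-trans (max-hi-strictMono mi mj i<j) (proj₂ (max⇒⊑ mj))
    init-nonempty : IsInterval init
    init-nonempty = ℤ.≤-<-trans s≤i (F-nonempty (max⇒∈F mi))
    init⊑s : init ⊑ s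
    init⊑s = ℤ.≤-refl , ℤ.<⇒≤ hi<hs
    below-j⇒⊑init : lo a ≤ y → y < lo j → Member F s y a → a ⊑ init
    below-j⇒⊑init {a} a≤y y<j (member Fa a⊑s _) =
      let M , mM , a⊑M = ∃-max-above Fa a⊑s
          M≤i = ℤ.≮⇒≥ λ i<M → gap mM i<M (ℤ.≤-<-trans (ℤ.≤-trans (proj₁ a⊑M) a≤y) y<j)
      in proj₁ a⊑s , ℤ.≤-trans (proj₂ a⊑M) (max-hi-mono mM mi M≤i)
    covered : ∀ y → y ∈ᵢ init → CoveredTwice F init y
    covered y (s≤y , y<i) with lo j ≤? y
    ... | yes j≤y = i , newInterval i j , (λ e → ℤ.<-irrefl (cong lo e) i<j) ,
                    member (max⇒∈F mi) (s≤i , ℤ.≤-refl) (ℤ.≤-trans (ℤ.<⇒≤ i<j) j≤y , y<i) ,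
                    member Fn (proj₁ (max⇒⊑ mj) , ℤ.≤-refl) (j≤y , y<i)
    ... | no  j≰y = coveredTwice-mono (λ M → below-j⇒⊑init (proj₁ (Member.∋x M)) (ℤ.≰⇒> j≰y) M)
                      (bad⇒coveredTwice bad-s (s≤y , ℤ.<-trans y<i hi<hs))

  confined⇒⊑ : ∀ {t} → Bad F t → x ∈ᵢ s → x ∈ᵢ t →
               (∀ {a} → Member F s x a → a ⊑ t) → (∀ {a} → Member F t x a → a ⊑ s) → s ⊑ t
  confined⇒⊑ {t = t} bad-t x∈s x∈t s→t t→s =
    let lo≤x , x<hi = ∈ᵢ-∩ x∈s x∈t
        s∩t≡s = bad-⊑⇒≡ (ℤ.≤-<-trans lo≤x x<hi) ∩-⊑ˡ (bad-∩ bad-s bad-t x∈s x∈t s→t t→s)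
    in subst (_⊑ t) s∩t≡s (∩-⊑ʳ {s})

module DescentAtPoint (F : Family) (F-nonempty : ∀ {i} → T (F i) → IsInterval i)
                (s t : IntervalCode) (minimal : MinimalBad F s) (bad-t : Bad F t) (s⋢t : ¬ s ⊑ t)
                (x : ℤ) (x∈t : x ∈ᵢ t) where

  open MaximalMembers F F-nonempty s
  open MinimalBadInterval F F-nonempty s minimal

  G : Family
  G = F ↓ s

  NewMember : IntervalCode → Set
  NewMember n = Member G t x n × ¬ T (F n)

  NewBetween : ℤ → ℤ → Set
  NewBetween l h = ∃ λ n → NewMember n × l < lo n × lo n ≤ h

  MaxInside : IntervalCode → Set
  MaxInside a = Max a × a ⊑ t × x ∈ᵢ a

  MaxOutside : IntervalCode → Set
  MaxOutside m = Max m × x ∈ᵢ m × ¬ m ⊑ t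

  MaxOutside? : Decidable MaxOutside
  MaxOutside? m = Max? m ×-dec x ∈ᵢ? m ×-dec ¬? (m ⊑? t)

  survives : Member F t x f → ¬ Max f → Member G t x f
  survives (member Ff f⊑t x∈f) ¬mf = member (survivor∈↓ Ff ¬mf) f⊑t x∈f

  old≢new : T (F f) → ¬ T (F n) → f ≢ n
  old≢new Ff n∉F refl = n∉F Ff

  newInterval-isNew : Consecutive i j → x ∈ᵢ newInterval i j → newInterval i j ⊑ t →
                    NewMember (newInterval i j)
  newInterval-isNew C x∈n n⊑t = member (newInterval∈↓ C) n⊑t x∈n , newInterval∉F C

  new-right-of : MaxInside a → Max b → x ∈ᵢ b → lo a < lo b → NewBetween (lo a) (lo b)
  new-right-of {a} (ma , a⊑t , _ , x<a) mb (b≤x , _) a<b =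
    let j , C@(_ , _ , a<j , _) , j≤b = successor ma mb a<b
    in newInterval a j ,
       newInterval-isNew C (ℤ.≤-trans j≤b b≤x , x<a) (ℤ.≤-trans (proj₁ a⊑t) (ℤ.<⇒≤ a<j) , proj₂ a⊑t) ,
       a<j , j≤b

  new-left-of : Max a → x ∈ᵢ a → MaxInside b → lo a < lo b → NewBetween (lo a) (lo b)
  new-left-of {b = b} ma (_ , x<a) (mb , b⊑t , b≤x , _) a<b =
    let i , C@(mi , _ , i<b , _) , a≤i = predecessor ma mb a<b
        hi-i<hi-b = max-hi-strictMono mi mb i<b
    in newInterval i b ,
       newInterval-isNew C (b≤x , ℤ.<-≤-trans x<a (max-hi-mono ma mi a≤i))
                         (proj₁ b⊑t , ℤ.≤-trans (ℤ.<⇒≤ hi-i<hi-b) (proj₂ b⊑t)) ,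
       a<b , ℤ.≤-refl

  new-between-disjoint : NewBetween l z → NewBetween z h → CoveredTwice G t x
  new-between-disjoint (n , (Mn , _) , _ , n≤z) (n′ , (Mn′ , _) , z<n′ , _) =
    n , n′ , (λ e → ℤ.<-irrefl (cong lo e) (ℤ.≤-<-trans n≤z z<n′)) , Mn , Mn′

  two-new-members : MaxInside a → MaxInside b → lo a < lo b → MaxOutside m → CoveredTwice G t x
  two-new-members {a} {b} {m} A@(ma , a⊑t , x∈a) B@(mb , b⊑t , x∈b) a<b (mm , x∈m , m⋢t)
    with ℤ.<-cmp (lo b) (lo m)
  ... | tri< b<m _ _ = new-between-disjoint (new-right-of A mb x∈b a<b) (new-right-of B mm x∈m b<m)
  ... | tri≈ _ b≡m _ = ⊥-elim (m⋢t (subst (_⊑ t) (max-lo-injective mb mm b≡m) b⊑t))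
  ... | tri> _ _ m<b with ℤ.<-cmp (lo m) (lo a)
  ...   | tri< m<a _ _ = new-between-disjoint (new-left-of mm x∈m A m<a) (new-left-of ma x∈a B a<b)
  ...   | tri≈ _ m≡a _ = ⊥-elim (m⋢t (subst (_⊑ t) (max-lo-injective ma mm (sym m≡a)) a⊑t))
  ...   | tri> _ _ a<m = ⊥-elim (m⋢t (ℤ.≤-trans (proj₁ a⊑t) (ℤ.<⇒≤ a<m) ,
                                      ℤ.<⇒≤ (ℤ.<-≤-trans (max-hi-strictMono mm mb m<b) (proj₂ b⊑t))))

  new-member : MaxInside a → MaxOutside m → ∃ NewMember
  new-member A@(ma , a⊑t , _) (mm , x∈m , m⋢t) with max-lo-cmp ma mm (λ a≡m → m⋢t (subst (_⊑ t) a≡m a⊑t))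
  ... | inj₁ a<m = let n , new , _ = new-right-of A mm x∈m a<m in n , new
  ... | inj₂ m<a = let n , new , _ = new-left-of mm x∈m A m<a in n , new

  outside? : Dec (∃ MaxOutside)
  outside? = ∃?-within MaxOutside? (pairsIn s) (max⇒∈pairsIn ∘ proj₁)

  module AllMaxInside (x∈s : x ∈ᵢ s) (max⊑t : ∀ {m} → Max m → x ∈ᵢ m → m ⊑ t) where

    s-members⊑t : Member F s x g → g ⊑ t
    s-members⊑t (member Fg g⊑s x∈g) =
      let M , mM , g⊑M = ∃-max-above Fg g⊑s in ⊑-trans g⊑M (max⊑t mM (∈ᵢ-⊑ x∈g g⊑M))

    s-member-inside : Member F s x g → Max g → MaxInside g
    s-member-inside (member _ _ x∈g) mg = mg , max⊑t mg x∈g , x∈g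

    survivor≢ : ¬ f ⊑ s → Member F s x g → ¬ Max g → ∃ λ g′ → Member G t x g′ × f ≢ g′
    survivor≢ f⋢s M@(member Fg g⊑s x∈g) ¬mg =
      _ , member (survivor∈↓ Fg ¬mg) (s-members⊑t M) x∈g , λ f≡g → f⋢s (subst (_⊑ s) (sym f≡g) g⊑s)

    new-member≢ : T (F f) → NewBetween l h → ∃ λ n → Member G t x n × f ≢ n
    new-member≢ Ff (n , (Mn , n∉F) , _) = n , Mn , old≢new Ff n∉F

    another-member : T (F f) → ¬ f ⊑ s → ∃ λ g → Member G t x g × f ≢ g
    another-member Ff f⋢s with bad⇒coveredTwice bad-s x∈s
    ... | g₁ , g₂ , g₁≢g₂ , M₁ , M₂ with Max? g₁ | Max? g₂
    ... | no ¬m₁ | _      = survivor≢ f⋢s M₁ ¬m₁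
    ... | yes _  | no ¬m₂ = survivor≢ f⋢s M₂ ¬m₂
    ... | yes m₁ | yes m₂ with max-lo-cmp m₁ m₂ g₁≢g₂
    ...   | inj₁ g₁<g₂ = new-member≢ Ff (new-right-of (s-member-inside M₁ m₁) m₂ (Member.∋x M₂) g₁<g₂)
    ...   | inj₂ g₂<g₁ = new-member≢ Ff (new-right-of (s-member-inside M₂ m₂) m₁ (Member.∋x M₁) g₂<g₁)

    Escapes? : Decidable (λ f → Member F t x f × ¬ f ⊑ s)
    Escapes? f = member? F t x f ×-dec ¬? (f ⊑? s)

    coveredTwice : CoveredTwice G t x
    coveredTwice with ∃?-within Escapes? (pairsIn t) (member⇒∈pairsIn ∘ proj₁)
    ... | yes (f , Mf , f⋢s) =
      let g , Mg , f≢g = another-member (Member.∈F Mf) f⋢s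
      in f , g , f≢g , survives Mf (f⋢s ∘ max⇒⊑) , Mg
    ... | no ¬escape = ⊥-elim (s⋢t (confined⇒⊑ bad-t x∈s x∈t s-members⊑t t-members⊑s))
      where
      t-members⊑s : Member F t x f → f ⊑ s
      t-members⊑s {f} M with f ⊑? s
      ... | yes f⊑s = f⊑s
      ... | no  f⋢s = ⊥-elim (¬escape (f , M , f⋢s))

  covered-when-all-inside : MaxInside a → ¬ ∃ MaxOutside → CoveredTwice G t x
  covered-when-all-inside (ma , _ , x∈a) ¬out = AllMaxInside.coveredTwice (∈ᵢ-⊑ x∈a (max⇒⊑ ma)) max⊑t
    where
    max⊑t : Max m → x ∈ᵢ m → m ⊑ t
    max⊑t {m} mm x∈m with m ⊑? t
    ... | yes m⊑t = m⊑t
    ... | no  m⋢t = ⊥-elim (¬out (m , mm , x∈m , m⋢t))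

  t-member-inside : Member F t x f → Max f → MaxInside f
  t-member-inside (member _ f⊑t x∈f) mf = mf , f⊑t , x∈f

  covered-with-survivor : Member F t x f → ¬ Max f → MaxInside a → CoveredTwice G t x
  covered-with-survivor Mf ¬mf A with outside?
  ... | yes (_ , out) = let n , Mn , n∉F = new-member A out
                        in _ , n , old≢new (Member.∈F Mf) n∉F , survives Mf ¬mf , Mn
  ... | no  ¬out      = covered-when-all-inside A ¬out

  coveredTwice : CoveredTwice G t x
  coveredTwice with bad⇒coveredTwice bad-t x∈t
  ... | f₁ , f₂ , f₁≢f₂ , M₁ , M₂ with Max? f₁ | Max? f₂
  ... | no ¬m₁ | no ¬m₂ = f₁ , f₂ , f₁≢f₂ , survives M₁ ¬m₁ , survives M₂ ¬m₂
  ... | yes m₁ | no ¬m₂ = covered-with-survivor M₂ ¬m₂ (t-member-inside M₁ m₁)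
  ... | no ¬m₁ | yes m₂ = covered-with-survivor M₁ ¬m₁ (t-member-inside M₂ m₂)
  ... | yes m₁ | yes m₂ with outside?
  ...   | no  ¬out = covered-when-all-inside (t-member-inside M₁ m₁) ¬out
  ...   | yes (_ , out) with max-lo-cmp m₁ m₂ f₁≢f₂
  ...     | inj₁ f₁<f₂ = two-new-members (t-member-inside M₁ m₁) (t-member-inside M₂ m₂) f₁<f₂ out
  ...     | inj₂ f₂<f₁ = two-new-members (t-member-inside M₂ m₂) (t-member-inside M₁ m₁) f₂<f₁ out

mainTheorem8 : (F : Family) → IsFamily F → (s t : IntervalCode) → IsInterval s → IsInterval t
    → MinimalBad F s → Bad F t → ¬ (s ⊆ᵢ t) → Bad (F ↓ s) t
mainTheorem8 F isF s t _ _ minimal bad-t s⊈t =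
  coveredTwice⇒bad λ x x∈t →
    DescentAtPoint.coveredTwice F F-nonempty s t minimal bad-t (s⊈t ∘ ⊑⇒⊆ᵢ) x x∈t
  where
  F-nonempty : ∀ {i} → T (F i) → IsInterval i
  F-nonempty {i} Fi = proj₁ isF i (to T-≡ Fi)
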